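{- Let $G$ be a graph, $k$ an integer, and $\tau$ a $k$-tangle in $G$. For any two distinct elements $(A,B),(C,D)$ of $\tau$ that are maximal in $\tau$ with respect to the partial order $\le$ on separations, we have $$|B\cap(C\cap D)|+|D\cap(A\cap B)|>|A\cap(C\cap D)|+|C\cap(A\cap B)|.$$
   Context: A separation of a graph $G=(V,E)$ is a pair $(A,B)$ of subsets of $V$ with $A\cup B=V$ such that $G$ has no edge between $A\setminus B$ and $B\setminus A$; its order is $|A\cap B|$. Separations are partially ordered by $(A,B)\le(C,D)$ if and only if $A\subseteq C$ and $B\supseteq D$. For an integer $k$, a $k$-tangle in $G$ is a set $\tau$ of separations of $G$ containing exactly one of $(A,B)$ and $(B,A)$ for every separation $(A,B)$ of $G$ of order $<k$ (and no other separations), such that there are no $(A_1,B_1),(A_2,B_2),(A_3,B_3)\in\tau$ (not necessarily distinct) with $G=G[A_1]\cup G[A_2]\cup G[A_3]$. -}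

module Defs where

open import Data.Nat using (ℕ)
open import Data.Integer using (ℤ; +_) renaming (_<_ to _<ℤ_)
open import Data.Fin using (Fin)
open import Data.Fin.Subset using (Subset; _∈_; _∉_; _⊆_; _∩_; _∪_; ∣_∣; ⊤)
open import Data.Product using (_×_; Σ)
open import Data.Sum using (_⊎_)
open import Relation.Nullary using (¬_)
open import Relation.Binary.PropositionalEquality using (_≡_)

record Graph : Set₁ where
  field
    n      : ℕ
    Adj    : Fin n → Fin n → Set
    sym    : ∀ {u v} → Adj u v → Adj v u
    irrefl : ∀ {u} → ¬ Adj u u

module _ (G : Graph) where
  open Graph G

  Vset : Set
  Vset = Subset n

  IsSeparation : Vset → Vset → Set
  IsSeparation A B =
    (∀ v → v ∈ A ⊎ v ∈ B) ×
    (∀ u v → u ∈ A → u ∉ B → v ∈ B → v ∉ A → ¬ Adj u v)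

  order : Vset → Vset → ℕ
  order A B = ∣ A ∩ B ∣

  _≤ˢ_ : (Vset × Vset) → (Vset × Vset) → Set
  (A Data.Product., B) ≤ˢ (C Data.Product., D) = A ⊆ C × D ⊆ B

  -- G = G[A₁] ∪ G[A₂] ∪ G[A₃]: every vertex lies in some Aᵢ and every edge
  -- has both ends in some Aᵢ.
  Covers3 : Vset → Vset → Vset → Set
  Covers3 A₁ A₂ A₃ =
    (∀ v → v ∈ A₁ ⊎ v ∈ A₂ ⊎ v ∈ A₃) ×
    (∀ u v → Adj u v →
       (u ∈ A₁ × v ∈ A₁) ⊎ (u ∈ A₂ × v ∈ A₂) ⊎ (u ∈ A₃ × v ∈ A₃))

  record IsTangle (k : ℤ) (τ : Vset → Vset → Set) : Set where
    field
      onlySeps  : ∀ A B → τ A B → IsSeparation A B × (+ order A B) <ℤ k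
      orients   : ∀ A B → IsSeparation A B → (+ order A B) <ℤ k →
                  τ A B ⊎ τ B A
      exclusive : ∀ A B → IsSeparation A B → (+ order A B) <ℤ k →
                  ¬ (τ A B × τ B A)
      noCover   : ∀ A₁ B₁ A₂ B₂ A₃ B₃ →
                  τ A₁ B₁ → τ A₂ B₂ → τ A₃ B₃ → ¬ Covers3 A₁ A₂ A₃

  MaximalIn : (Vset → Vset → Set) → Vset → Vset → Set
  MaximalIn τ A B =
    τ A B ×
    (∀ C D → τ C D → (A Data.Product., B) ≤ˢ (C Data.Product., D) →
       (C ≡ A × D ≡ B))

-- The corner separation (A ∪ C , B ∩ D) has order at least k: otherwise τ
-- orients it, and either orientation is impossible — (A ∪ C , B ∩ D) lies
-- above both maximal elements, forcing them to coincide, while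
-- (B ∩ D , A ∪ C) together with (A , B) and (C , D) covers G.  Since
-- (A , B) and (C , D) have order < k, the inequality follows from the count,
-- valid whenever A ∪ B and C ∪ D are the whole vertex set,
--   |B∩C∩D| + |D∩A∩B| + |A∩B| + |C∩D| = 2 |(A∪C)∩B∩D| + |A∩C∩D| + |C∩A∩B|,
-- which is checked vertex by vertex.
module Submission where

open import Defs
open import Data.Nat using (_+_; _>_)
open import Data.Integer using (ℤ)
open import Data.Fin.Subset using (_∩_; ∣_∣)
open import Data.Product using (_×_)
open import Relation.Nullary using (¬_)
open import Relation.Binary.PropositionalEquality using (_≡_)

open import Algebra.Properties.CommutativeSemigroup using (interchange)
open import Data.Bool using (Bool; true; false; _∧_; _∨_)
open import Data.Empty using (⊥-elim)
open import Data.Fin.Subset using (Subset; _∪_; _∈_; _∉_; ⊤)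
open import Data.Fin.Subset.Properties
  using (_∈?_; x∈p∩q⁺; x∈p∪q⁺; p⊆p∪q; q⊆p∪q; p∩q⊆p; p∩q⊆q; ⊆⊤; ⊆-antisym)
open import Data.Integer using (+_) renaming (_<_ to _<ℤ_; _≤_ to _≤ℤ_)
open import Data.Integer.Properties using (_<?_; ≮⇒≥; <-≤-trans; drop‿+<+)
open import Data.Nat using (ℕ; _<_)
open import Data.Nat.Properties using (+-comm; +-commutativeSemigroup; +-cancelʳ-<; +-mono-<; +-monoʳ-<; module ≤-Reasoning)
open import Data.Nat.Solver using (module +-*-Solver)
open import Data.Product using (_,_; proj₁; proj₂; swap)
open import Data.Sum using (_⊎_; inj₁; inj₂; [_,_]) renaming (swap to ⊎-swap)
open import Data.Vec using (Vec; []; _∷_; map; sum; zipWith)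
open import Data.Vec.Properties using (∷-injectiveˡ; ∷-injectiveʳ)
open import Function using (id; _∘_)
open import Relation.Nullary using (yes; no)
open import Relation.Nullary.Decidable using (_×-dec_)
open import Relation.Binary.PropositionalEquality using (refl; sym; trans; cong₂; module ≡-Reasoning)

toℕ : Bool → ℕ
toℕ true  = 1
toℕ false = 0

∣∷∣ : ∀ {n} b (p : Subset n) → ∣ b ∷ p ∣ ≡ toℕ b + ∣ p ∣
∣∷∣ true  p = refl
∣∷∣ false p = refl

sum-∣∣-zipWith-∷ : ∀ {m n} (bs : Vec Bool m) (ps : Vec (Subset n) m) →
  sum (map ∣_∣ (zipWith _∷_ bs ps)) ≡ sum (map toℕ bs) + sum (map ∣_∣ ps)
sum-∣∣-zipWith-∷ []       []       = refl
sum-∣∣-zipWith-∷ (b ∷ bs) (p ∷ ps) = begin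
  ∣ b ∷ p ∣ + sum (map ∣_∣ (zipWith _∷_ bs ps))
    ≡⟨ cong₂ _+_ (∣∷∣ b p) (sum-∣∣-zipWith-∷ bs ps) ⟩
  (toℕ b + ∣ p ∣) + (sum (map toℕ bs) + sum (map ∣_∣ ps))
    ≡⟨ interchange +-commutativeSemigroup (toℕ b) ∣ p ∣ _ _ ⟩
  (toℕ b + sum (map toℕ bs)) + (∣ p ∣ + sum (map ∣_∣ ps))  ∎
  where open ≡-Reasoning

sum-∣∣-zipWith-∷-cong : ∀ {m m′ n} (bs : Vec Bool m) (cs : Vec Bool m′)
  (ps : Vec (Subset n) m) (qs : Vec (Subset n) m′) →
  sum (map toℕ bs) ≡ sum (map toℕ cs) →
  sum (map ∣_∣ ps) ≡ sum (map ∣_∣ qs) →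
  sum (map ∣_∣ (zipWith _∷_ bs ps)) ≡ sum (map ∣_∣ (zipWith _∷_ cs qs))
sum-∣∣-zipWith-∷-cong bs cs ps qs bs≡cs ps≡qs =
  trans (sum-∣∣-zipWith-∷ bs ps)
    (trans (cong₂ _+_ bs≡cs ps≡qs) (sym (sum-∣∣-zipWith-∷ cs qs)))

-- Stated over any pair of operations so that, on subsets, the terms for
-- a ∷ A, b ∷ B, … are definitionally zipWith _∷_ of the Boolean terms and the
-- terms for A, B, …; this is what drives the induction in corner-count.
module _ {X : Set} (_⊓_ _⊔_ : X → X → X) (A B C D : X) where

  corner-lhs : Vec X 4
  corner-lhs = B ⊓ (C ⊓ D) ∷ D ⊓ (A ⊓ B) ∷ A ⊓ B ∷ C ⊓ D ∷ []

  corner-rhs : Vec X 4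
  corner-rhs = (A ⊔ C) ⊓ (B ⊓ D) ∷ (A ⊔ C) ⊓ (B ⊓ D) ∷ A ⊓ (C ⊓ D) ∷ C ⊓ (A ⊓ B) ∷ []

corner-count-bit : ∀ a b c d → a ∨ b ≡ true → c ∨ d ≡ true →
  sum (map toℕ (corner-lhs _∧_ _∨_ a b c d)) ≡ sum (map toℕ (corner-rhs _∧_ _∨_ a b c d))
corner-count-bit false false _     _     () _
corner-count-bit _     _     false false _  ()
corner-count-bit true  true  true  true  _  _ = refl
corner-count-bit true  true  true  false _  _ = refl
corner-count-bit true  true  false true  _  _ = refl
corner-count-bit true  false true  true  _  _ = refl
corner-count-bit true  false true  false _  _ = refl
corner-count-bit true  false false true  _  _ = refl
corner-count-bit false true  true  true  _  _ = refl
corner-count-bit false true  true  false _  _ = refl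
corner-count-bit false true  false true  _  _ = refl

corner-count : ∀ {n} (A B C D : Subset n) → A ∪ B ≡ ⊤ → C ∪ D ≡ ⊤ →
  sum (map ∣_∣ (corner-lhs _∩_ _∪_ A B C D)) ≡ sum (map ∣_∣ (corner-rhs _∩_ _∪_ A B C D))
corner-count []      []      []      []      _    _    = refl
corner-count (a ∷ A) (b ∷ B) (c ∷ C) (d ∷ D) AB≡⊤ CD≡⊤ =
  sum-∣∣-zipWith-∷-cong (corner-lhs _∧_ _∨_ a b c d) (corner-rhs _∧_ _∨_ a b c d)
    (corner-lhs _∩_ _∪_ A B C D) (corner-rhs _∩_ _∪_ A B C D)
    (corner-count-bit a b c d (∷-injectiveˡ AB≡⊤) (∷-injectiveˡ CD≡⊤))
    (corner-count A B C D (∷-injectiveʳ AB≡⊤) (∷-injectiveʳ CD≡⊤))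

excess-of-balance : ∀ {L₁ L₂ R₁ R₂ X Y S} →
  sum (L₁ ∷ L₂ ∷ X ∷ Y ∷ []) ≡ sum (S ∷ S ∷ R₁ ∷ R₂ ∷ []) →
  X < S → Y < S → L₁ + L₂ > R₁ + R₂
excess-of-balance {L₁} {L₂} {R₁} {R₂} {X} {Y} {S} balance X<S Y<S =
  +-cancelʳ-< (X + Y) (R₁ + R₂) (L₁ + L₂) (begin-strict
    (R₁ + R₂) + (X + Y)          <⟨ +-monoʳ-< (R₁ + R₂) (+-mono-< X<S Y<S) ⟩
    (R₁ + R₂) + (S + S)          ≡⟨ +-comm (R₁ + R₂) (S + S) ⟩
    (S + S) + (R₁ + R₂)          ≡⟨ regroup S S R₁ R₂ ⟩
    sum (S ∷ S ∷ R₁ ∷ R₂ ∷ [])   ≡⟨ sym balance ⟩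
    sum (L₁ ∷ L₂ ∷ X ∷ Y ∷ [])   ≡⟨ sym (regroup L₁ L₂ X Y) ⟩
    (L₁ + L₂) + (X + Y)          ∎)
  where
  open ≤-Reasoning
  open +-*-Solver
  regroup : ∀ a b c d → (a + b) + (c + d) ≡ sum (a ∷ b ∷ c ∷ d ∷ [])
  regroup = solve 4 (λ a b c d → (a :+ b) :+ (c :+ d) := a :+ (b :+ (c :+ (d :+ con 0)))) refl

module _ {n : ℕ} {A B : Subset n} (A∪B : ∀ v → v ∈ A ⊎ v ∈ B) where

  ∉ʳ⇒∈ˡ : ∀ {v} → v ∉ B → v ∈ A
  ∉ʳ⇒∈ˡ {v} v∉B = [ id , (λ v∈B → ⊥-elim (v∉B v∈B)) ] (A∪B v)

  ∪≡⊤ : A ∪ B ≡ ⊤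
  ∪≡⊤ = ⊆-antisym ⊆⊤ (λ {v} _ → x∈p∪q⁺ (A∪B v))

module Separations (G : Graph) where
  open Graph G using (Adj)

  neighbour∈ˡ : ∀ {A B} → IsSeparation G A B → ∀ {u v} → Adj u v → u ∉ B → v ∈ A
  neighbour∈ˡ {A} (cover , no-edge) {u} {v} uv u∉B with v ∈? A
  ... | yes v∈A = v∈A
  ... | no  v∉A = ⊥-elim (no-edge u v (∉ʳ⇒∈ˡ cover u∉B) u∉B (∉ʳ⇒∈ˡ (⊎-swap ∘ cover) v∉A) v∉A uv)

  edge⊄ˡ⇒∈ʳ : ∀ {A B} → IsSeparation G A B → ∀ {u v} → Adj u v → ¬ (u ∈ A × v ∈ A) → u ∈ B
  edge⊄ˡ⇒∈ʳ {B = B} sep@(cover , _) {u} uv uv⊄A with u ∈? B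
  ... | yes u∈B = u∈B
  ... | no  u∉B = ⊥-elim (uv⊄A (∉ʳ⇒∈ˡ cover u∉B , neighbour∈ˡ sep uv u∉B))

  ∪∩-isSeparation : ∀ {A B C D} → IsSeparation G A B → IsSeparation G C D →
    IsSeparation G (A ∪ C) (B ∩ D)
  ∪∩-isSeparation {A} {B} {C} {D} sep₁@(cover₁ , _) sep₂@(cover₂ , _) = cover , no-edge
    where
    cover : ∀ v → v ∈ A ∪ C ⊎ v ∈ B ∩ D
    cover v with cover₁ v | cover₂ v
    ... | inj₁ v∈A | _        = inj₁ (x∈p∪q⁺ (inj₁ v∈A))
    ... | _        | inj₁ v∈C = inj₁ (x∈p∪q⁺ (inj₂ v∈C))
    ... | inj₂ v∈B | inj₂ v∈D = inj₂ (x∈p∩q⁺ (v∈B , v∈D))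
    no-edge : ∀ u v → u ∈ A ∪ C → u ∉ B ∩ D → v ∈ B ∩ D → v ∉ A ∪ C → ¬ Adj u v
    no-edge u v _ u∉B∩D _ v∉A∪C uv with u ∈? B | u ∈? D
    ... | yes u∈B | yes u∈D = u∉B∩D (x∈p∩q⁺ (u∈B , u∈D))
    ... | no  u∉B | _       = v∉A∪C (x∈p∪q⁺ (inj₁ (neighbour∈ˡ sep₁ uv u∉B)))
    ... | _       | no  u∉D = v∉A∪C (x∈p∪q⁺ (inj₂ (neighbour∈ˡ sep₂ uv u∉D)))

  covers3-∩ʳ : ∀ {A B C D} → IsSeparation G A B → IsSeparation G C D →
    Covers3 G A C (B ∩ D)
  covers3-∩ʳ {A} {B} {C} {D} sep₁@(cover₁ , _) sep₂@(cover₂ , _) = cover , cover-edges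
    where
    cover : ∀ v → v ∈ A ⊎ v ∈ C ⊎ v ∈ B ∩ D
    cover v with cover₁ v | cover₂ v
    ... | inj₁ v∈A | _        = inj₁ v∈A
    ... | _        | inj₁ v∈C = inj₂ (inj₁ v∈C)
    ... | inj₂ v∈B | inj₂ v∈D = inj₂ (inj₂ (x∈p∩q⁺ (v∈B , v∈D)))
    cover-edges : ∀ u v → Adj u v →
      (u ∈ A × v ∈ A) ⊎ (u ∈ C × v ∈ C) ⊎ (u ∈ B ∩ D × v ∈ B ∩ D)
    cover-edges u v uv with u ∈? A ×-dec v ∈? A | u ∈? C ×-dec v ∈? C
    ... | yes uv⊆A | _        = inj₁ uv⊆A
    ... | _        | yes uv⊆C = inj₂ (inj₁ uv⊆C)
    ... | no  uv⊄A | no  uv⊄C = inj₂ (inj₂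
      ( x∈p∩q⁺ (edge⊄ˡ⇒∈ʳ sep₁ uv uv⊄A , edge⊄ˡ⇒∈ʳ sep₂ uv uv⊄C)
      , x∈p∩q⁺ (edge⊄ˡ⇒∈ʳ sep₁ vu (uv⊄A ∘ swap) , edge⊄ˡ⇒∈ʳ sep₂ vu (uv⊄C ∘ swap))))
      where vu = Graph.sym G uv

  module Tangle {k : ℤ} {τ : Vset G → Vset G → Set} (tangle : IsTangle G k τ) where
    open IsTangle tangle

    τ-isSeparation : ∀ {A B} → τ A B → IsSeparation G A B
    τ-isSeparation AB∈τ = proj₁ (onlySeps _ _ AB∈τ)

    τ-order< : ∀ {A B} → τ A B → + order G A B <ℤ k
    τ-order< AB∈τ = proj₂ (onlySeps _ _ AB∈τ)

    corner-order-≥ : ∀ {A B C D} → MaximalIn G τ A B → MaximalIn G τ C D →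
      ¬ (A ≡ C × B ≡ D) → k ≤ℤ + order G (A ∪ C) (B ∩ D)
    corner-order-≥ {A} {B} {C} {D} (AB∈τ , AB-max) (CD∈τ , CD-max) AB≢CD
      with + order G (A ∪ C) (B ∩ D) <? k
    ... | no  ≮k = ≮⇒≥ ≮k
    ... | yes <k
      with orients (A ∪ C) (B ∩ D) (∪∩-isSeparation (τ-isSeparation AB∈τ) (τ-isSeparation CD∈τ)) <k
    ... | inj₂ corner⁻¹∈τ = ⊥-elim (noCover A B C D (B ∩ D) (A ∪ C) AB∈τ CD∈τ corner⁻¹∈τ
                              (covers3-∩ʳ (τ-isSeparation AB∈τ) (τ-isSeparation CD∈τ)))
    ... | inj₁ corner∈τ
      with AB-max _ _ corner∈τ (p⊆p∪q C , p∩q⊆p B D) | CD-max _ _ corner∈τ (q⊆p∪q A C , p∩q⊆q B D)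
    ... | A∪C≡A , B∩D≡B | A∪C≡C , B∩D≡D = ⊥-elim
      (AB≢CD (trans (sym A∪C≡A) A∪C≡C , trans (sym B∩D≡B) B∩D≡D))

lemma2 : (G : Graph) (k : ℤ) (τ : Vset G → Vset G → Set) →
    IsTangle G k τ →
    (A B C D : Vset G) →
    MaximalIn G τ A B → MaximalIn G τ C D → ¬ (A ≡ C × B ≡ D) →
    ∣ B ∩ (C ∩ D) ∣ + ∣ D ∩ (A ∩ B) ∣ > ∣ A ∩ (C ∩ D) ∣ + ∣ C ∩ (A ∩ B) ∣
lemma2 G k τ tangle A B C D AB-max@(AB∈τ , _) CD-max@(CD∈τ , _) AB≢CD =
  excess-of-balance {∣ B ∩ (C ∩ D) ∣} {∣ D ∩ (A ∩ B) ∣} {∣ A ∩ (C ∩ D) ∣} {∣ C ∩ (A ∩ B) ∣}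
    (corner-count A B C D (∪≡⊤ (proj₁ (τ-isSeparation AB∈τ))) (∪≡⊤ (proj₁ (τ-isSeparation CD∈τ))))
    (below-corner AB∈τ) (below-corner CD∈τ)
  where
  open Separations G
  open Tangle tangle
  below-corner : ∀ {X Y} → τ X Y → order G X Y < order G (A ∪ C) (B ∩ D)
  below-corner XY∈τ = drop‿+<+ (<-≤-trans (τ-order< XY∈τ) (corner-order-≥ AB-max CD-max AB≢CD))
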